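{- Let $G$ be a minimal Kochen-Specker graph. Then every vertex of $G$ is adjacent to at least three other vertices (i.e. $G$ has minimum vertex degree at least $3$).
   Context: All graphs are finite simple graphs. Identify antipodal points of the unit sphere in $\mathbb{R}^3$, i.e. work in the real projective plane (points are lines through the origin in $\mathbb{R}^3$); two such points are orthogonal if the corresponding lines are orthogonal. For a finite subset $S$ of the projective plane, its orthogonality graph $G(S)$ has vertex set $S$, with two vertices adjacent iff the corresponding points are orthogonal. A graph $G$ is embeddable if it is (isomorphic to) a subgraph, not necessarily induced, of $G(S)$ for some finite subset $S$ of the projective plane. A graph is 010-colorable if there is a map from its vertices to $\{0,1\}$ such that (1) in every triangle exactly one vertex is colored $1$, and (2) no two adjacent vertices are both colored $1$. A Kochen-Specker graph is an embeddable graph that is not 010-colorable. A minimal Kochen-Specker graph is a Kochen-Specker graph with the least number of vertices among all Kochen-Specker graphs. -}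

module Defs where

open import Level using (0ℓ)
open import Data.Nat using (ℕ; _≤_)
open import Data.Fin using (Fin)
open import Data.Bool using (Bool; true; false)
open import Data.List using (List; filterᵇ; length)
open import Data.List.Base using (allFin)
open import Data.Product using (Σ; ∃; _×_; _,_)
open import Data.Sum using (_⊎_)
open import Relation.Nullary using (¬_)
open import Relation.Binary.PropositionalEquality using (_≡_; _≢_)
open import Relation.Binary.Structures using (IsStrictTotalOrder)
open import Algebra.Structures using (IsCommutativeRing)

-- The real numbers, axiomatised classically as a Dedekind-complete
-- ordered field (any model is isomorphic to ℝ).  The theorem is stated
-- for every such model.

record Reals : Set₁ where
  infixl 6 _+_
  infixl 7 _*_
  field
    Carrier : Set
    _+_ _*_ : Carrier → Carrier → Carrier
    -_      : Carrier → Carrier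
    0# 1#   : Carrier
    _<_     : Carrier → Carrier → Set
    isCommutativeRing : IsCommutativeRing _≡_ _+_ _*_ -_ 0# 1#
    0≢1     : 0# ≢ 1#
    inverse : ∀ x → x ≢ 0# → Σ Carrier (λ y → x * y ≡ 1#)
    isStrictTotalOrder : IsStrictTotalOrder _≡_ _<_
    +-mono-< : ∀ x y z → x < y → (x + z) < (y + z)
    *-pos    : ∀ x y → 0# < x → 0# < y → 0# < (x * y)
    lub : (P : Carrier → Set) → Σ Carrier P →
          Σ Carrier (λ b → ∀ x → P x → (x < b ⊎ x ≡ b)) →
          Σ Carrier (λ s → (∀ x → P x → (x < s ⊎ x ≡ s)) ×
                           (∀ b → (∀ x → P x → (x < b ⊎ x ≡ b)) → (s < b ⊎ s ≡ b)))

-- Points of the real projective plane, represented by nonzero vectors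
-- of ℝ³ (two representatives give the same point iff proportional).

module Projective (R : Reals) where
  open Reals R

  record Vec3 : Set where
    constructor vec
    field x y z : Carrier

  Nonzero : Vec3 → Set
  Nonzero (vec a b c) = ¬ (a ≡ 0# × b ≡ 0# × c ≡ 0#)

  SameLine : Vec3 → Vec3 → Set
  SameLine (vec a b c) (vec a' b' c') =
    Σ Carrier (λ t → a ≡ t * a' × b ≡ t * b' × c ≡ t * c')

  Orthogonal : Vec3 → Vec3 → Set
  Orthogonal (vec a b c) (vec a' b' c') = a * a' + b * b' + c * c' ≡ 0#

record Graph : Set where
  field
    n     : ℕ
    adj   : Fin n → Fin n → Bool
    sym   : ∀ i j → adj i j ≡ adj j i
    irrefl : ∀ i → adj i i ≡ false
open Graph public

Adj : (G : Graph) → Fin (n G) → Fin (n G) → Set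
Adj G i j = adj G i j ≡ true

degree : (G : Graph) → Fin (n G) → ℕ
degree G i = length (filterᵇ (adj G i) (allFin (n G)))

-- G is a (not necessarily induced) subgraph of the orthogonality graph
-- of a finite set of points of the real projective plane: an injective
-- assignment of projective points to vertices under which adjacent
-- vertices go to orthogonal points.
Embeddable : Reals → Graph → Set
Embeddable R G =
  Σ (Fin (n G) → Vec3)
    (λ f → (∀ i → Nonzero (f i))
         × (∀ i j → SameLine (f i) (f j) → i ≡ j)
         × (∀ i j → Adj G i j → Orthogonal (f i) (f j)))
  where open Projective R

count1 : Bool → ℕ
count1 true = 1
count1 false = 0

Colorable010 : Graph → Set
Colorable010 G =
  Σ (Fin (n G) → Bool)
    (λ c → (∀ i j k → Adj G i j → Adj G j k → Adj G i k →
              count1 (c i) Data.Nat.+ count1 (c j) Data.Nat.+ count1 (c k) ≡ 1)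
         × (∀ i j → Adj G i j → ¬ (c i ≡ true × c j ≡ true)))

KochenSpecker : Reals → Graph → Set
KochenSpecker R G = Embeddable R G × ¬ Colorable010 G

MinimalKS : Reals → Graph → Set
MinimalKS R G = KochenSpecker R G × (∀ H → KochenSpecker R H → n G ≤ n H)

module Submission where

-- Idea: suppose a vertex v of a Kochen–Specker graph G has degree < 3.
-- Deleting v leaves an induced subgraph G − v which is still embeddable
-- (restrict the embedding) and, as we show, still not 010-colourable: any
-- 010-colouring of G − v extends to G by colouring v with 1 exactly when no
-- neighbour of v is coloured 1.  The only new triangles are {v, x, y} with
-- x, y the (at most two) neighbours of v, and for those the rule works.
-- So G − v is a smaller Kochen–Specker graph, contradicting minimality.

open import Defs
open import Data.Nat using (_≤_)
open import Data.Fin using (Fin)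

open import Data.Nat using (ℕ; suc; _<_; _+_; _≤?_; s≤s)
open import Data.Nat.Properties using (n<1+n; <⇒≱; ≰⇒>; +-comm; +-assoc)
open import Data.Fin as Fin using (zero; suc; punchIn; punchOut) renaming (_≟_ to _≟ᶠ_)
open import Data.Fin.Properties using (pigeonhole; any?; punchIn-injective; punchInᵢ≢i; punchIn-punchOut)
open import Data.Vec as Vec using (_∷_; [])
open import Data.Bool using (Bool; true; false; not; T?)
open import Data.Bool.Properties using (¬-not; T-≡) renaming (_≟_ to _≟ᵇ_)
open import Data.List using (List; length; lookup; filterᵇ)
open import Data.List.Base using (allFin)
open import Data.List.Membership.Propositional using (_∈_)
open import Data.List.Membership.Propositional.Properties using (∈-filter⁺; ∈-allFin)
open import Data.List.Relation.Unary.Any using (index)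
open import Data.List.Relation.Unary.Any.Properties using (lookup-index)
open import Data.Product using (∃; ∃₂; _×_; _,_)
open import Data.Sum using (_⊎_; inj₁; inj₂)
open import Function using (_∘_; Injective)
open import Function.Bundles using (Equivalence)
open import Relation.Nullary using (¬_; Dec; yes; no; does; contradiction)
open import Relation.Nullary.Decidable using (_×-dec_)
open import Relation.Binary.PropositionalEquality as ≡ using (_≡_; _≢_; refl; trans; cong; module ≡-Reasoning)

-- Pigeonhole principle for lists: more than `length xs` values, all taken
-- from `xs`, contain a repetition (distinct members occupy distinct positions).
members-collide : {A : Set} {k : ℕ} (xs : List A) → length xs < k →
                  (f : Fin k → A) → (∀ i → f i ∈ xs) →
                  ∃₂ λ i j → i Fin.< j × f i ≡ f j
members-collide xs len<k f f∈xs
  with i , j , i<j , samePosition ← pigeonhole len<k (λ i → index (f∈xs i)) =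
  i , j , i<j , (begin
    f i                        ≡⟨ lookup-index (f∈xs i) ⟩
    lookup xs (index (f∈xs i)) ≡⟨ cong (lookup xs) samePosition ⟩
    lookup xs (index (f∈xs j)) ≡⟨ ≡.sym (lookup-index (f∈xs j)) ⟩
    f j                        ∎)
  where open ≡-Reasoning

sum-swap : ∀ a b c → a + b + c ≡ b + a + c
sum-swap a b c = cong (_+ c) (+-comm a b)

sum-rotate : ∀ a b c → a + b + c ≡ b + c + a
sum-rotate a b c = trans (+-assoc a b c) (+-comm a (b + c))

true≢false : true ≢ false
true≢false ()

module _ (G : Graph) where

  Adj-sym : ∀ {i j} → Adj G i j → Adj G j i
  Adj-sym {i} {j} a = trans (Graph.sym G j i) a

  adjacent-distinct : ∀ {i j} → Adj G i j → i ≢ j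
  adjacent-distinct {i} a refl with trans (≡.sym a) (irrefl G i)
  ... | ()

  neighbour∈ : ∀ {v x} → Adj G v x → x ∈ filterᵇ (adj G v) (allFin (n G))
  neighbour∈ {v} {x} a =
    ∈-filter⁺ (T? ∘ adj G v) (∈-allFin x) (Equivalence.from T-≡ a)

  at-most-two-neighbours : ∀ {v x y w} → degree G v < 3 →
    Adj G v x → Adj G v y → Adj G v w → x ≢ y → w ≡ x ⊎ w ≡ y
  at-most-two-neighbours {x = x} {y} {w} low ax ay aw x≢y
    with members-collide _ low (Vec.lookup (x ∷ y ∷ w ∷ []))
           (λ { zero → neighbour∈ ax ; (suc zero) → neighbour∈ ay ; (suc (suc zero)) → neighbour∈ aw })
  ... | zero           , suc zero       , _  , x≡y = contradiction x≡y x≢y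
  ... | zero           , suc (suc zero) , _  , x≡w = inj₁ (≡.sym x≡w)
  ... | suc zero       , suc (suc zero) , _  , y≡w = inj₂ (≡.sym y≡w)
  ... | zero           , zero           , () , _
  ... | suc zero       , zero           , () , _
  ... | suc zero       , suc zero       , s≤s () , _
  ... | suc (suc zero) , zero           , () , _
  ... | suc (suc zero) , suc zero       , s≤s () , _
  ... | suc (suc zero) , suc (suc zero) , s≤s (s≤s ()) , _

induced : (G : Graph) {k : ℕ} → (Fin k → Fin (n G)) → Graph
induced G {k} ι = record
  { n      = k
  ; adj    = λ i j → adj G (ι i) (ι j)
  ; sym    = λ i j → Graph.sym G (ι i) (ι j)
  ; irrefl = λ i → irrefl G (ι i)
  }

induced-embeddable : (R : Reals) (G : Graph) {k : ℕ} {ι : Fin k → Fin (n G)} →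
  Injective _≡_ _≡_ ι → Embeddable R G → Embeddable R (induced G ι)
induced-embeddable R G {ι = ι} ι-injective (f , nonzero , f-injective , orthogonal) =
    f ∘ ι
  , nonzero ∘ ι
  , (λ i j sameLine → ι-injective (f-injective (ι i) (ι j) sameLine))
  , (λ i j → orthogonal (ι i) (ι j))

record Deletion {N : ℕ} (v : Fin N) : Set where
  field
    size      : ℕ
    smaller   : size < N
    ι         : Fin size → Fin N
    injective : Injective _≡_ _≡_ ι
    avoids    : ∀ j → ι j ≢ v
    covers    : ∀ i → i ≢ v → ∃ λ j → ι j ≡ i

deletion : {N : ℕ} (v : Fin N) → Deletion v
deletion {suc m} v = record
  { size      = m
  ; smaller   = n<1+n m
  ; ι         = punchIn v
  ; injective = punchIn-injective v _ _
  ; avoids    = punchInᵢ≢i v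
  ; covers    = λ i i≢v → punchOut (i≢v ∘ ≡.sym) , punchIn-punchOut (i≢v ∘ ≡.sym)
  }

module Extension (G : Graph) {v : Fin (n G)} (D : Deletion v)
                 (low : degree G v < 3) where
  open Deletion D

  H : Graph
  H = induced G ι

  data Split (i : Fin (n G)) : Set where
    deleted : i ≡ v → Split i
    kept    : ∀ j → ι j ≡ i → Split i

  split : ∀ i → Split i
  split i with i ≟ᶠ v
  ... | yes i≡v = deleted i≡v
  ... | no i≢v  = let j , ιj≡i = covers i i≢v in kept j ιj≡i

  module _ (c′ : Fin size → Bool)
    (triangles′ : ∀ i j k → Adj H i j → Adj H j k → Adj H i k →
                  count1 (c′ i) + count1 (c′ j) + count1 (c′ k) ≡ 1)
    (independent′ : ∀ i j → Adj H i j → ¬ (c′ i ≡ true × c′ j ≡ true)) where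

    neighbour-on? : Dec (∃ λ j → Adj G v (ι j) × c′ j ≡ true)
    neighbour-on? = any? λ j → (adj G v (ι j) ≟ᵇ true) ×-dec (c′ j ≟ᵇ true)

    colourOf : ∀ {i} → Split i → Bool
    colourOf (deleted _) = not (does neighbour-on?)
    colourOf (kept j _)  = c′ j

    c : Fin (n G) → Bool
    c i = colourOf (split i)

    c-kept : ∀ j → c (ι j) ≡ c′ j
    c-kept j with split (ι j)
    ... | deleted ιj≡v   = contradiction ιj≡v (avoids j)
    ... | kept j′ ιj′≡ιj = cong c′ (injective ιj′≡ιj)

    c-deleted : c v ≡ not (does neighbour-on?)
    c-deleted with split v
    ... | deleted _      = refl
    ... | kept j ιj≡v    = contradiction ιj≡v (avoids j)

    v-on⇒no-neighbour-on : c v ≡ true → ¬ ∃ λ j → Adj G v (ι j) × c′ j ≡ true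
    v-on⇒no-neighbour-on cv with neighbour-on? | c-deleted
    ... | yes _    | cv≡false = λ _ → true≢false (trans (≡.sym cv) cv≡false)
    ... | no none  | _        = none

    v-off⇒neighbour-on : c v ≡ false → ∃ λ x → Adj G v x × c x ≡ true
    v-off⇒neighbour-on cv with neighbour-on? | c-deleted
    ... | yes (j , avj , c′j) | _       = ι j , avj , trans (c-kept j) c′j
    ... | no _                | cv≡true = contradiction (trans (≡.sym cv) cv≡true) λ ()

    neighbour-off : ∀ {x y} → Adj G x y → c x ≡ true → c y ≡ false
    neighbour-off {x} {y} = by-cases (split x) (split y)
      where
      by-cases : ∀ {x y} → Split x → Split y → Adj G x y → c x ≡ true → c y ≡ false
      by-cases (deleted refl) (deleted refl) axy _  = contradiction refl (adjacent-distinct G axy)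
      by-cases (deleted refl) (kept j refl)  axy cx = ¬-not λ cy →
        v-on⇒no-neighbour-on cx (j , axy , trans (≡.sym (c-kept j)) cy)
      by-cases (kept i refl)  (deleted refl) axy cx = ¬-not λ cy →
        v-on⇒no-neighbour-on cy (i , Adj-sym G axy , trans (≡.sym (c-kept i)) cx)
      by-cases (kept i refl)  (kept j refl)  axy cx = ¬-not λ cy →
        independent′ i j axy (trans (≡.sym (c-kept i)) cx , trans (≡.sym (c-kept j)) cy)

    -- The new triangles, those through v, contain exactly one vertex
    -- coloured 1.  If v is coloured 0 its neighbour coloured 1 must lie
    -- on the triangle, since v has only two neighbours.
    triangle-at-v : ∀ {x y} → Adj G v x → Adj G v y → Adj G x y →
                    count1 (c v) + count1 (c x) + count1 (c y) ≡ 1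
    triangle-at-v ax ay axy with c v in cv
    ... | true rewrite neighbour-off ax cv | neighbour-off ay cv = refl
    ... | false with v-off⇒neighbour-on cv
    ... | w , aw , cw with at-most-two-neighbours G low ax ay aw (adjacent-distinct G axy)
    ... | inj₁ refl rewrite cw | neighbour-off axy cw = refl
    ... | inj₂ refl rewrite cw | neighbour-off (Adj-sym G axy) cw = refl

    triangle : ∀ i j k → Adj G i j → Adj G j k → Adj G i k →
               count1 (c i) + count1 (c j) + count1 (c k) ≡ 1
    triangle i j k = by-cases (split i) (split j) (split k)
      where
      by-cases : ∀ {i j k} → Split i → Split j → Split k →
                 Adj G i j → Adj G j k → Adj G i k →
                 count1 (c i) + count1 (c j) + count1 (c k) ≡ 1
      by-cases (deleted refl) _ _ aij ajk aik = triangle-at-v aij aik ajk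
      by-cases {i} {_} {k} (kept _ _) (deleted refl) _ aij ajk aik =
        trans (sum-swap (count1 (c i)) (count1 (c v)) (count1 (c k)))
              (triangle-at-v (Adj-sym G aij) ajk aik)
      by-cases {i} {j} (kept _ _) (kept _ _) (deleted refl) aij ajk aik =
        trans (≡.sym (sum-rotate (count1 (c v)) (count1 (c i)) (count1 (c j))))
              (triangle-at-v (Adj-sym G aik) (Adj-sym G ajk) aij)
      by-cases (kept i′ refl) (kept j′ refl) (kept k′ refl) aij ajk aik
        rewrite c-kept i′ | c-kept j′ | c-kept k′ = triangles′ i′ j′ k′ aij ajk aik

    colouring : Colorable010 G
    colouring = c , triangle , λ i j aij (ci , cj) →
      true≢false (trans (≡.sym cj) (neighbour-off aij ci))

  extend : Colorable010 H → Colorable010 G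
  extend (c′ , triangles′ , independent′) = colouring c′ triangles′ independent′

_−_ : (G : Graph) → Fin (n G) → Graph
G − v = induced G (Deletion.ι (deletion v))

deletion-preserves-KS : (R : Reals) (G : Graph) (v : Fin (n G)) →
  degree G v < 3 → KochenSpecker R G → KochenSpecker R (G − v)
deletion-preserves-KS R G v low (embeddable , uncolourable) =
    induced-embeddable R G (Deletion.injective (deletion v)) embeddable
  , uncolourable ∘ Extension.extend G (deletion v) low

mainTheorem1 : (R : Reals) (G : Graph) → MinimalKS R G →
               (v : Fin (n G)) → 3 ≤ degree G v
mainTheorem1 R G (ks , minimal) v with 3 ≤? degree G v
... | yes enough = enough
... | no few     =
  contradiction (minimal (G − v) (deletion-preserves-KS R G v (≰⇒> few) ks))
                (<⇒≱ (Deletion.smaller (deletion v)))
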